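{- For all SCL-terms $P, Q \in \mathrm{ST}$: if $\mathrm{EqFSCL} \vdash P = Q$, then $\mathrm{se}(P) = \mathrm{se}(Q)$ (i.e. $\mathrm{FSCL}_{\mathrm{se}} \vDash P = Q$).
   Context: Let $A$ be a countable set of atoms. The set $\mathrm{ST}$ of SCL-terms is generated by $P ::= a \ (a \in A) \mid \mathsf{T} \mid \mathsf{F} \mid \neg P \mid (P \wedge^{\circ} P) \mid (P \vee^{\circ} P)$, where $\wedge^{\circ}$ and $\vee^{\circ}$ denote short-circuit left-sequential conjunction and disjunction. Let $\mathcal{T}$ be the set of finite binary trees: $\mathsf{T}, \mathsf{F} \in \mathcal{T}$ and $(X \trianglelefteq a \trianglerighteq Y) \in \mathcal{T}$ for $X, Y \in \mathcal{T}$, $a \in A$. Leaf replacement: $\mathsf{T}[\mathsf{T}\mapsto Y, \mathsf{F}\mapsto Z] = Y$, $\mathsf{F}[\mathsf{T}\mapsto Y, \mathsf{F}\mapsto Z] = Z$, $(X' \trianglelefteq a \trianglerighteq X'')[\mathsf{T}\mapsto Y, \mathsf{F}\mapsto Z] = X'[\ldots] \trianglelefteq a \trianglerighteq X''[\ldots]$; unmentioned leaves are unchanged. The short-circuit evaluation $\mathrm{se}: \mathrm{ST} \to \mathcal{T}$: $\mathrm{se}(\mathsf{T}) = \mathsf{T}$, $\mathrm{se}(\mathsf{F}) = \mathsf{F}$, $\mathrm{se}(a) = \mathsf{T} \trianglelefteq a \trianglerighteq \mathsf{F}$, $\mathrm{se}(\neg P) = \mathrm{se}(P)[\mathsf{T}\mapsto\mathsf{F},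 \mathsf{F}\mapsto\mathsf{T}]$, $\mathrm{se}(P \wedge^{\circ} Q) = \mathrm{se}(P)[\mathsf{T}\mapsto \mathrm{se}(Q)]$, $\mathrm{se}(P \vee^{\circ} Q) = \mathrm{se}(P)[\mathsf{F}\mapsto \mathrm{se}(Q)]$. $\mathrm{FSCL}_{\mathrm{se}} \vDash P = Q$ iff $\mathrm{se}(P) = \mathrm{se}(Q)$. $\mathrm{EqFSCL}$ is the set of equations: $\mathsf{F} = \neg\mathsf{T}$; $x \vee^{\circ} y = \neg(\neg x \wedge^{\circ} \neg y)$; $\neg\neg x = x$; $(x \wedge^{\circ} y) \wedge^{\circ} z = x \wedge^{\circ} (y \wedge^{\circ} z)$; $\mathsf{T} \wedge^{\circ} x = x$; $x \wedge^{\circ} \mathsf{T} = x$; $\mathsf{F} \wedge^{\circ} x = \mathsf{F}$; $x \wedge^{\circ} \mathsf{F} = \neg x \wedge^{\circ} \mathsf{F}$; $(x \wedge^{\circ} \mathsf{F}) \vee^{\circ} y = (x \vee^{\circ} \mathsf{T}) \wedge^{\circ} y$; $(x \wedge^{\circ} y) \vee^{\circ} (z \wedge^{\circ} \mathsf{F}) = (x \vee^{\circ} (z \wedge^{\circ} \mathsf{F})) \wedge^{\circ} (y \vee^{\circ} (z \wedge^{\circ} \mathsf{F}))$. $\mathrm{EqFSCL} \vdash s = t$ means derivability by equational logic from $\mathrm{EqFSCL}$. -}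

module Defs where

open import Data.Nat using (ℕ)
open import Data.Empty using (⊥)
open import Relation.Binary.PropositionalEquality using (_≡_)

Atom : Set
Atom = ℕ

-- Terms over atoms and variables from V (variables are used for the
-- equations of EqFSCL).  SCL-terms ST are the variable-free terms.
data Tm (V : Set) : Set where
  var  : V → Tm V
  atom : Atom → Tm V
  `T   : Tm V
  `F   : Tm V
  ¬_   : Tm V → Tm V
  _∧∘_ : Tm V → Tm V → Tm V
  _∨∘_ : Tm V → Tm V → Tm V

infix  9 ¬_
infixr 6 _∧∘_
infixr 5 _∨∘_

ST : Set
ST = Tm ⊥

data Tree : Set where
  T    : Tree
  F    : Tree
  node : Tree → Atom → Tree → Tree   -- node X a Y  =  X ⊴ a ⊵ Y

_[T↦_,F↦_] : Tree → Tree → Tree → Tree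
T [T↦ Y ,F↦ Z ] = Y
F [T↦ Y ,F↦ Z ] = Z
node X a X' [T↦ Y ,F↦ Z ] = node (X [T↦ Y ,F↦ Z ]) a (X' [T↦ Y ,F↦ Z ])

-- Short-circuit evaluation se : ST → 𝒯
-- (unmentioned leaves unchanged: [T ↦ Y] = [T ↦ Y, F ↦ F], etc.)
se : ST → Tree
se (var ())
se (atom a) = node T a F
se `T = T
se `F = F
se (¬ P) = se P [T↦ F ,F↦ T ]
se (P ∧∘ Q) = se P [T↦ se Q ,F↦ F ]
se (P ∨∘ Q) = se P [T↦ T ,F↦ se Q ]

data Var : Set where
  x y z : Var

data Axiom : Tm Var → Tm Var → Set where
  FSCL1  : Axiom `F (¬ `T)
  FSCL2  : Axiom (var x ∨∘ var y) (¬ (¬ var x ∧∘ ¬ var y))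
  FSCL3  : Axiom (¬ ¬ var x) (var x)
  FSCL4  : Axiom ((var x ∧∘ var y) ∧∘ var z) (var x ∧∘ (var y ∧∘ var z))
  FSCL5  : Axiom (`T ∧∘ var x) (var x)
  FSCL6  : Axiom (var x ∧∘ `T) (var x)
  FSCL7  : Axiom (`F ∧∘ var x) `F
  FSCL8  : Axiom (var x ∧∘ `F) (¬ var x ∧∘ `F)
  FSCL9  : Axiom ((var x ∧∘ `F) ∨∘ var y) ((var x ∨∘ `T) ∧∘ var y)
  FSCL10 : Axiom ((var x ∧∘ var y) ∨∘ (var z ∧∘ `F))
                 ((var x ∨∘ (var z ∧∘ `F)) ∧∘ (var y ∨∘ (var z ∧∘ `F)))

subst : {V : Set} → (V → ST) → Tm V → ST
subst σ (var v) = σ v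
subst σ (atom a) = atom a
subst σ `T = `T
subst σ `F = `F
subst σ (¬ P) = ¬ subst σ P
subst σ (P ∧∘ Q) = subst σ P ∧∘ subst σ Q
subst σ (P ∨∘ Q) = subst σ P ∨∘ subst σ Q

infix 4 EqFSCL⊢_≈_
data EqFSCL⊢_≈_ : ST → ST → Set where
  ax     : ∀ {l r} → Axiom l r → (σ : Var → ST) → EqFSCL⊢ subst σ l ≈ subst σ r
  refl≈  : ∀ {P} → EqFSCL⊢ P ≈ P
  sym≈   : ∀ {P Q} → EqFSCL⊢ P ≈ Q → EqFSCL⊢ Q ≈ P
  trans≈ : ∀ {P Q R} → EqFSCL⊢ P ≈ Q → EqFSCL⊢ Q ≈ R → EqFSCL⊢ P ≈ R
  cong¬  : ∀ {P P'} → EqFSCL⊢ P ≈ P' → EqFSCL⊢ ¬ P ≈ ¬ P'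
  cong∧  : ∀ {P P' Q Q'} → EqFSCL⊢ P ≈ P' → EqFSCL⊢ Q ≈ Q' → EqFSCL⊢ P ∧∘ Q ≈ P' ∧∘ Q'
  cong∨  : ∀ {P P' Q Q'} → EqFSCL⊢ P ≈ P' → EqFSCL⊢ Q ≈ Q' → EqFSCL⊢ P ∨∘ Q ≈ P' ∨∘ Q'

module Submission where

-- Leaf replacement X [T↦ Y ,F↦ Z] is the substitution (Kleisli extension)
-- of the tree "monad" with the two leaves T, F.  Only two general laws of
-- it are needed: replacements compose (replace-replace), and replacing each
-- leaf by itself is the identity (replace-id).  From them follows that the
-- negation swap T ↔ F is an involution.
--
-- Each axiom of EqFSCL is then sound for every instantiation of its
-- variables: the trivial ones hold by computation, the others are short
-- equational chains in these laws.

open import Defs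
open import Relation.Binary.PropositionalEquality
  using (_≡_; refl; sym; trans; cong; cong₂; module ≡-Reasoning)

open ≡-Reasoning

swap : Tree → Tree
swap X = X [T↦ F ,F↦ T ]

replace-replace : ∀ X Y Z Y' Z' →
  (X [T↦ Y ,F↦ Z ]) [T↦ Y' ,F↦ Z' ] ≡ X [T↦ Y [T↦ Y' ,F↦ Z' ] ,F↦ Z [T↦ Y' ,F↦ Z' ] ]
replace-replace T Y Z Y' Z' = refl
replace-replace F Y Z Y' Z' = refl
replace-replace (node X a X') Y Z Y' Z' =
  cong₂ (λ L R → node L a R) (replace-replace X Y Z Y' Z') (replace-replace X' Y Z Y' Z')

replace-id : ∀ X → X [T↦ T ,F↦ F ] ≡ X
replace-id T = refl
replace-id F = refl
replace-id (node X a X') = cong₂ (λ L R → node L a R) (replace-id X) (replace-id X')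

swap-involutive : ∀ X → swap (swap X) ≡ X
swap-involutive X = trans (replace-replace X F T F T) (replace-id X)

de-morgan : ∀ X Y → X [T↦ T ,F↦ Y ] ≡ swap (swap X [T↦ swap Y ,F↦ F ])
de-morgan X Y = sym (begin
  swap (swap X [T↦ swap Y ,F↦ F ])    ≡⟨ cong swap (replace-replace X F T (swap Y) F) ⟩
  swap (X [T↦ F ,F↦ swap Y ])         ≡⟨ replace-replace X F (swap Y) F T ⟩
  X [T↦ T ,F↦ swap (swap Y) ]         ≡⟨ cong (λ W → X [T↦ T ,F↦ W ]) (swap-involutive Y) ⟩
  X [T↦ T ,F↦ Y ]                     ∎)

-- (x ∧∘ F) ∨∘ y = (x ∨∘ T) ∧∘ y: both evaluate x and then y on every branch.
evaluate-then : ∀ X Y → (X [T↦ F ,F↦ F ]) [T↦ T ,F↦ Y ] ≡ (X [T↦ T ,F↦ T ]) [T↦ Y ,F↦ F ]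
evaluate-then X Y = begin
  (X [T↦ F ,F↦ F ]) [T↦ T ,F↦ Y ]    ≡⟨ replace-replace X F F T Y ⟩
  X [T↦ Y ,F↦ Y ]                    ≡⟨ sym (replace-replace X T T Y F) ⟩
  (X [T↦ T ,F↦ T ]) [T↦ Y ,F↦ F ]    ∎

-- (x ∧∘ y) ∨∘ (z ∧∘ F) = (x ∨∘ (z ∧∘ F)) ∧∘ (y ∨∘ (z ∧∘ F)): the tree W of
-- z ∧∘ F has only F-leaves, so W is unaffected by a later T-replacement.
distribute-false : ∀ X Y Z →
  let W = Z [T↦ F ,F↦ F ] in
  (X [T↦ Y ,F↦ F ]) [T↦ T ,F↦ W ] ≡ (X [T↦ T ,F↦ W ]) [T↦ Y [T↦ T ,F↦ W ] ,F↦ F ]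
distribute-false X Y Z = begin
  (X [T↦ Y ,F↦ F ]) [T↦ T ,F↦ W ]    ≡⟨ replace-replace X Y F T W ⟩
  X [T↦ A ,F↦ W ]                    ≡⟨ cong (λ V → X [T↦ A ,F↦ V ]) (sym (replace-replace Z F F A F)) ⟩
  X [T↦ A ,F↦ W [T↦ A ,F↦ F ] ]      ≡⟨ sym (replace-replace X T W A F) ⟩
  (X [T↦ T ,F↦ W ]) [T↦ A ,F↦ F ]    ∎
  where
    W = Z [T↦ F ,F↦ F ]
    A = Y [T↦ T ,F↦ W ]

axiom-sound : ∀ {l r} → Axiom l r → (σ : Var → ST) → se (subst σ l) ≡ se (subst σ r)
axiom-sound FSCL1  σ = refl
axiom-sound FSCL2  σ = de-morgan (se (σ x)) (se (σ y))
axiom-sound FSCL3  σ = swap-involutive (se (σ x))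
axiom-sound FSCL4  σ = replace-replace (se (σ x)) (se (σ y)) F (se (σ z)) F
axiom-sound FSCL5  σ = refl
axiom-sound FSCL6  σ = replace-id (se (σ x))
axiom-sound FSCL7  σ = refl
axiom-sound FSCL8  σ = sym (replace-replace (se (σ x)) F T F F)
axiom-sound FSCL9  σ = evaluate-then (se (σ x)) (se (σ y))
axiom-sound FSCL10 σ = distribute-false (se (σ x)) (se (σ y)) (se (σ z))

sound : ∀ {P Q} → EqFSCL⊢ P ≈ Q → se P ≡ se Q
sound (ax a σ)     = axiom-sound a σ
sound refl≈        = refl
sound (sym≈ d)     = sym (sound d)
sound (trans≈ d e) = trans (sound d) (sound e)
sound (cong¬ d)    = cong swap (sound d)
sound (cong∧ d e)  = cong₂ (λ L R → L [T↦ R ,F↦ F ]) (sound d) (sound e)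
sound (cong∨ d e)  = cong₂ (λ L R → L [T↦ T ,F↦ R ]) (sound d) (sound e)

mainTheorem3 : (P Q : ST) → EqFSCL⊢ P ≈ Q → se P ≡ se Q
mainTheorem3 _ _ = sound
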